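{- Let $\mathcal{U}$ be a nonempty finite universe with $n=|\mathcal{U}|$, let $\mathcal{F}$ be a finite family of subsets of $\mathcal{U}$ whose union is $\mathcal{U}$, and let $\beta>1$. Run the algorithm StaticGreedy (described in the context) on $\mathcal{E}=\mathcal{U}$ and $\mathcal{S}=\{s\in\mathcal{F}: s\cap\mathcal{U}\neq\emptyset\}$, with arbitrary choices at each selection step. Then for every $s\in\mathcal{F}$ and every nonnegative integer $j\le\log_\beta n$, we have $|N_j(s)|<\beta^j$, where $N_j(s)=\{e\in s:\mathsf{lev}(e)<j\}$.
   Context: StaticGreedy$(\mathcal{E},\mathcal{S},\beta)$: Initialize $\mathcal{C}=\emptyset$. Throughout, $\mathcal{E}$ denotes the current set of uncovered elements (initially the input). Place each $s\in\mathcal{S}$ at level $\lfloor\log_\beta|s\cap\mathcal{E}|\rfloor$. For $l$ from $\lceil\log_\beta|\mathcal{E}|\rceil$ (computed at the start) down to $0$: while level $l$ is nonempty, take an arbitrary set $s$ at level $l$ and remove it from level $l$; if $|s\cap\mathcal{E}|\ge\beta^l$, add $s$ to $\mathcal{C}$ and set $\mathcal{E}\leftarrow\mathcal{E}\setminus(s\cap\mathcal{E})$; otherwise, if $|s\cap\mathcal{E}|>0$ place $s$ at level $\lfloor\log_\beta|s\cap\mathcal{E}|\rfloor$, and if $|s\cap\mathcal{E}|=0$ place $s$ at level $-1$ (never processed again). Output $\mathcal{C}$. Definitions: for $s\in\mathcal{F}$, $\mathsf{cov}(s)\subseteq s$ is the set of elements removed from the uncovered set $\mathcal{E}$ at the moment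 $s$ was added to $\mathcal{C}$; $\mathsf{cov}(s)=\emptyset$ if $s\notin\mathcal{C}$. $\mathsf{lev}(s)$ is the level $l$ from which $s$ was added to $\mathcal{C}$, with $\mathsf{lev}(s)=-1$ if $s\notin\mathcal{C}$; for each $e\in\mathsf{cov}(s)$, $\mathsf{lev}(e)=\mathsf{lev}(s)$.
   Formalization: The parameter β ranges only over rational numbers greater than 1. -}

module Defs where

open import Data.Nat using (ℕ; zero; suc; _<_; _<ᵇ_)
open import Data.Bool using (Bool; true; false; _∧_)
open import Data.Fin using (Fin)
open import Data.Fin.Subset using (Subset; _∩_; _─_; ∣_∣; ⊤; _∈_)
open import Data.Fin.Subset.Properties using (_∈?_)
open import Data.List using (List; []; _∷_; _++_)
open import Data.Maybe using (Maybe; just; nothing)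
open import Data.Product using (_×_; _,_; ∃)
open import Data.Vec using (tabulate)
open import Data.Integer using (+_)
open import Data.Rational using (ℚ; _*_; _≤_; _<_; 1ℚ)
open import Relation.Binary.PropositionalEquality using (_≡_; _≢_)
open import Relation.Nullary using (¬_)
open import Relation.Nullary.Decidable using (⌊_⌋)

_^ℚ_ : ℚ → ℕ → ℚ
β ^ℚ zero  = 1ℚ
β ^ℚ suc l = β * (β ^ℚ l)

toℚ : ℕ → ℚ
toℚ k = Data.Rational._/_ (+ k) 1

FloorLog : ℚ → ℕ → ℕ → Set
FloorLog β k l = (β ^ℚ l ≤ toℚ k) × (toℚ k Data.Rational.< β ^ℚ suc l)

CeilLog : ℚ → ℕ → ℕ → Set
CeilLog β k L = (toℚ k ≤ β ^ℚ L) × (∀ L′ → L′ Data.Nat.< L → ¬ (toℚ k ≤ β ^ℚ L′))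

-- One entry of the output cover C: the index of the chosen set s,
-- lev(s), and cov(s) (the elements newly covered by s).
record Entry (n m : ℕ) : Set where
  constructor entry
  field
    set : Fin m
    lev : ℕ
    cov : Subset n

levOf : ∀ {n m} → List (Entry n m) → Fin n → Maybe ℕ
levOf [] e = nothing
levOf (entry i l c ∷ C) e with e ∈? c
... | Relation.Nullary.yes _ = just l
... | Relation.Nullary.no _  = levOf C e

levLt : Maybe ℕ → ℕ → Bool
levLt nothing  j = false
levLt (just l) j = l <ᵇ j

N : ∀ {n m} → List (Entry n m) → ℕ → Subset n → Subset n
N C j s = tabulate (λ e → ⌊ e ∈? s ⌋ ∧ levLt (levOf C e) j)

data Phase : Set where
  at   : ℕ → Phase
  done : Phase

-- State of StaticGreedy on universe Fin n with family F : Fin m → Subset n.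
--   bucket i = just l  : set i currently sits at level l (l ≥ 0)
--   bucket i = nothing : set i is at level -1 / not in S / removed for good
record State (n m : ℕ) : Set where
  constructor state
  field
    phase  : Phase
    E      : Subset n
    bucket : Fin m → Maybe ℕ
    C      : List (Entry n m)

update : ∀ {m} {A : Set} → (Fin m → A) → Fin m → A → (Fin m → A)
update f i a j with Data.Fin._≟_ i j
... | Relation.Nullary.yes _ = a
... | Relation.Nullary.no _  = f j

Initial : ∀ {n m} → ℚ → (Fin m → Subset n) → State n m → Set
Initial {n} β F (state ph E b C) =
  ∃ λ L → CeilLog β n L × ph ≡ at L × E ≡ ⊤ × C ≡ [] ×
    (∀ i → (∣ F i ∩ ⊤ ∣ ≡ 0 × b i ≡ nothing)
         Data.Sum.⊎ (∃ λ l → ∣ F i ∩ ⊤ ∣ ≢ 0 × FloorLog β ∣ F i ∩ ⊤ ∣ l × b i ≡ just l))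
  where import Data.Sum

data Step {n m : ℕ} (β : ℚ) (F : Fin m → Subset n) : State n m → State n m → Set where
  take : ∀ {l E b C} i → b i ≡ just l →
         β ^ℚ l ≤ toℚ ∣ F i ∩ E ∣ →
         Step β F (state (at l) E b C)
                  (state (at l) (E ─ (F i ∩ E)) (update b i nothing)
                         (C ++ (entry i l (F i ∩ E) ∷ [])))
  demote : ∀ {l l′ E b C} i → b i ≡ just l →
         toℚ ∣ F i ∩ E ∣ Data.Rational.< β ^ℚ l →
         ∣ F i ∩ E ∣ ≢ 0 →
         FloorLog β ∣ F i ∩ E ∣ l′ →
         Step β F (state (at l) E b C) (state (at l) E (update b i (just l′)) C)
  discard : ∀ {l E b C} i → b i ≡ just l →
         ∣ F i ∩ E ∣ ≡ 0 →
         Step β F (state (at l) E b C) (state (at l) E (update b i nothing) C)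
  down : ∀ {l E b C} → (∀ i → b i ≢ just (suc l)) →
         Step β F (state (at (suc l)) E b C) (state (at l) E b C)
  finish : ∀ {E b C} → (∀ i → b i ≢ just 0) →
         Step β F (state (at 0) E b C) (state done E b C)

data Steps {n m : ℕ} (β : ℚ) (F : Fin m → Subset n) : State n m → State n m → Set where
  ε   : ∀ {σ} → Steps β F σ σ
  _◅_ : ∀ {σ τ υ} → Step β F σ τ → Steps β F τ υ → Steps β F σ υ

Run : ∀ {n m} → ℚ → (Fin m → Subset n) → List (Entry n m) → Set
Run {n} {m} β F C = ∃ λ σ₀ → ∃ λ E → ∃ λ b →
  Initial β F σ₀ × Steps β F σ₀ (state done E b C)

{-# OPTIONS --safe #-}
-- While level l is processed, every set s has |s ∩ E| < β^(l+1): a set waiting at a level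
-- l′ ≤ l has fewer than β^(l′+1) uncovered elements, and E only shrinks.  Levels are handed out
-- in decreasing order, so when the scan first reaches a level l < j no element has a level
-- below j yet, and |N_j(s) ∪ (s ∩ E)| = |s ∩ E| < β^j.  From then on this union can only
-- shrink, since every element of s that receives a level is uncovered at that moment.
module Submission where

open import Defs
open import Data.Bool using (T)
open import Data.Bool.Properties using (T-∧; T-≡)
open import Data.Empty using (⊥-elim)
open import Data.Fin using (Fin; _≟_)
open import Data.Fin.Subset
  using (Subset; inside; outside; _∩_; _∪_; _─_; ∣_∣; ⊤; _∈_; _∉_; _⊆_; Empty)
open import Data.Fin.Subset.Properties
  using (_∈?_; x∈p∩q⁺; x∈p∩q⁻; x∈p∪q⁺; x∈p∪q⁻; p─q⊆p; p⊆q⇒∣p∣≤∣q∣;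
         p∩q⊆q; p⊆p∪q; ∣p∣≤n; ∣⊥∣≡0; Empty-unique)
open import Data.Integer as ℤ using (+_)
import Data.Integer.Properties as ℤ
open import Data.List using (List; []; _∷_; _++_)
open import Data.Maybe using (Maybe; just; nothing; _<∣>_)
open import Data.Nat as ℕ using (ℕ; zero; suc; z≤n; s≤s)
import Data.Nat.Properties as ℕ
import Data.Nat.Coprimality as Coprime
open import Data.Product using (_×_; _,_; proj₁; proj₂; ∃)
open import Data.Sum using (_⊎_; inj₁; inj₂)
open import Data.Rational as ℚ using (ℚ; 0ℚ; 1ℚ; _*_; _<_; _≤_; mkℚ; *≤*)
import Data.Rational.Properties as ℚ
open import Data.Vec using (_∷_; here; there; lookup; tabulate)
open import Data.Vec.Properties using (lookup∘tabulate; []=⇒lookup; lookup⇒[]=)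
open import Function using (_∘_; Equivalence)
open import Relation.Binary.PropositionalEquality
open import Relation.Nullary using (yes; no)
open import Relation.Nullary.Decidable using (toWitness; fromWitness)

private
  variable
    k : ℕ
    x : Fin k
    p q : Subset k

∩-monoʳ-⊆ : ∀ r → p ⊆ q → r ∩ p ⊆ r ∩ q
∩-monoʳ-⊆ r p⊆q x∈r∩p with x∈p∩q⁻ r _ x∈r∩p
... | x∈r , x∈p = x∈p∩q⁺ (x∈r , p⊆q x∈p)

x∈p─q⇒x∉q : ∀ (p q : Subset k) → x ∈ p ─ q → x ∉ q
x∈p─q⇒x∉q (inside ∷ p) (outside ∷ q) here ()
x∈p─q⇒x∉q (inside  ∷ p) (outside ∷ q) (there x∈p─q) (there x∈q) = x∈p─q⇒x∉q p q x∈p─q x∈q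
x∈p─q⇒x∉q (_       ∷ p) (inside  ∷ q) (there x∈p─q) (there x∈q) = x∈p─q⇒x∉q p q x∈p─q x∈q
x∈p─q⇒x∉q (outside ∷ p) (outside ∷ q) (there x∈p─q) (there x∈q) = x∈p─q⇒x∉q p q x∈p─q x∈q

Empty[p∩[q─p∩q]] : ∀ (p q : Subset k) → Empty (p ∩ (q ─ (p ∩ q)))
Empty[p∩[q─p∩q]] p q (x , x∈) with x∈p∩q⁻ p _ x∈
... | x∈p , x∈q─p∩q =
  x∈p─q⇒x∉q q (p ∩ q) x∈q─p∩q (x∈p∩q⁺ (x∈p , p─q⊆p q (p ∩ q) x∈q─p∩q))

∣Empty∣≡0 : Empty p → ∣ p ∣ ≡ 0
∣Empty∣≡0 {k} p-empty = trans (cong ∣_∣ (Empty-unique p-empty)) (∣⊥∣≡0 k)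

toℚ≡mkℚ : ∀ a → toℚ a ≡ mkℚ (+ a) 0 (Coprime.sym (Coprime.1-coprimeTo a))
toℚ≡mkℚ a = ℚ.normalize-coprime (Coprime.sym (Coprime.1-coprimeTo a))

toℚ-mono-≤ : ∀ {a b} → a ℕ.≤ b → toℚ a ≤ toℚ b
toℚ-mono-≤ {a} {b} a≤b rewrite toℚ≡mkℚ a | toℚ≡mkℚ b =
  *≤* (subst₂ ℤ._≤_ (sym (ℤ.*-identityʳ (+ a))) (sym (ℤ.*-identityʳ (+ b))) (ℤ.+≤+ a≤b))

module _ {β : ℚ} (1<β : 1ℚ < β) where

  ^ℚ-pos : ∀ a → 0ℚ < β ^ℚ a
  ^ℚ-pos zero    = ℚ.positive⁻¹ 1ℚ
  ^ℚ-pos (suc a) = ℚ.positive⁻¹ (β * β ^ℚ a)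
    {{ℚ.pos*pos⇒pos β {{ℚ.positive (ℚ.<-trans (^ℚ-pos 0) 1<β)}} (β ^ℚ a) {{ℚ.positive (^ℚ-pos a)}}}}

  ^ℚ<^ℚ-suc : ∀ a → β ^ℚ a < β ^ℚ suc a
  ^ℚ<^ℚ-suc a = subst (_< β * β ^ℚ a) (ℚ.*-identityˡ (β ^ℚ a))
    (ℚ.*-monoˡ-<-pos (β ^ℚ a) {{ℚ.positive (^ℚ-pos a)}} 1<β)

  ^ℚ-monoʳ-≤ : ∀ {a b} → a ℕ.≤ b → β ^ℚ a ≤ β ^ℚ b
  ^ℚ-monoʳ-≤ {b = zero}  z≤n = ℚ.≤-refl
  ^ℚ-monoʳ-≤ {a} {suc b} a≤1+b with ℕ.m≤n⇒m<n∨m≡n a≤1+b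
  ... | inj₁ (s≤s a≤b) = ℚ.≤-trans (^ℚ-monoʳ-≤ a≤b) (ℚ.<⇒≤ (^ℚ<^ℚ-suc b))
  ... | inj₂ refl      = ℚ.≤-refl

  ^ℚ-monoʳ-< : ∀ {a b} → a ℕ.< b → β ^ℚ a < β ^ℚ b
  ^ℚ-monoʳ-< {a} a<b = ℚ.<-≤-trans (^ℚ<^ℚ-suc a) (^ℚ-monoʳ-≤ a<b)

  ^ℚ-cancelʳ-≤ : ∀ {a b} → β ^ℚ a ≤ β ^ℚ b → a ℕ.≤ b
  ^ℚ-cancelʳ-≤ βᵃ≤βᵇ = ℕ.≮⇒≥ λ b<a → ℚ.<-irrefl refl (ℚ.≤-<-trans βᵃ≤βᵇ (^ℚ-monoʳ-< b<a))

  ^ℚ-cancelʳ-< : ∀ {a b} → β ^ℚ a < β ^ℚ b → a ℕ.< b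
  ^ℚ-cancelʳ-< βᵃ<βᵇ = ℕ.≰⇒> λ b≤a → ℚ.<-irrefl refl (ℚ.<-≤-trans βᵃ<βᵇ (^ℚ-monoʳ-≤ b≤a))

update⁺ : ∀ {m} {A : Set} (P : Fin m → A → Set) {f : Fin m → A} {i a} →
          P i a → (∀ i′ → P i′ (f i′)) → ∀ i′ → P i′ (update f i a i′)
update⁺ P {i = i} Pia Pf i′ with i ≟ i′
... | yes refl = Pia
... | no _     = Pf i′

levOf-++ : ∀ {n m} (C D : List (Entry n m)) e → levOf (C ++ D) e ≡ levOf C e <∣> levOf D e
levOf-++ []                  D e = refl
levOf-++ (entry i l c ∷ C) D e with e ∈? c
... | yes _ = refl
... | no _  = levOf-++ C D e

∈-tabulate⁻ : ∀ {f : Fin k → _} → x ∈ tabulate f → T (f x)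
∈-tabulate⁻ {x = x} {f} x∈ =
  Equivalence.from T-≡ (trans (sym (lookup∘tabulate f x)) ([]=⇒lookup x∈))

∈-tabulate⁺ : ∀ {f : Fin k → _} → T (f x) → x ∈ tabulate f
∈-tabulate⁺ {x = x} {f} t =
  lookup⇒[]= x (tabulate f) (trans (lookup∘tabulate f x) (Equivalence.to T-≡ t))

levLt-<∣>⁻ : ∀ u v {j} → T (levLt (u <∣> v) j) → T (levLt u j) ⊎ T (levLt v j)
levLt-<∣>⁻ (just _) v t = inj₁ t
levLt-<∣>⁻ nothing  v t = inj₂ t

module _ {n m : ℕ} where

  ∈N⁻ : ∀ {C : List (Entry n m)} {j X e} → e ∈ N C j X → e ∈ X × T (levLt (levOf C e) j)
  ∈N⁻ e∈N with Equivalence.to T-∧ (∈-tabulate⁻ e∈N)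
  ... | e∈?X , lev<j = toWitness e∈?X , lev<j

  ∈N⁺ : ∀ {C : List (Entry n m)} {j X e} → e ∈ X → T (levLt (levOf C e) j) → e ∈ N C j X
  ∈N⁺ e∈X lev<j = ∈-tabulate⁺ (Equivalence.from T-∧ (fromWitness e∈X , lev<j))

  levLt-entry⁻ : ∀ {i l c j e} → T (levLt (levOf (entry {n} {m} i l c ∷ []) e) j) → e ∈ c × l ℕ.< j
  levLt-entry⁻ {l = l} {c} {j} {e} lev<j with e ∈? c
  ... | yes e∈c = e∈c , ℕ.<ᵇ⇒< l j lev<j
  ... | no _    = ⊥-elim lev<j

  N-take⁻ : ∀ {C : List (Entry n m)} {i l c j X e} → e ∈ N (C ++ entry i l c ∷ []) j X →
            e ∈ N C j X ⊎ (e ∈ X ∩ c × l ℕ.< j)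
  N-take⁻ {C} {i} {l} {c} {j} {X} {e} e∈N with ∈N⁻ {C ++ entry i l c ∷ []} e∈N
  ... | e∈X , lev<j
    with levLt-<∣>⁻ (levOf C e) _ (subst (λ u → T (levLt u j)) (levOf-++ C _ e) lev<j)
  ...   | inj₁ levC<j = inj₁ (∈N⁺ {C} e∈X levC<j)
  ...   | inj₂ levD<j with levLt-entry⁻ {i = i} levD<j
  ...     | e∈c , l<j = inj₂ (x∈p∩q⁺ (e∈X , e∈c) , l<j)

  N-[]-Empty : ∀ {j X} → Empty (N {n} {m} [] j X)
  N-[]-Empty {j} (e , e∈N) = proj₂ (∈N⁻ {[]} {j} e∈N)

  N-take-Empty : ∀ {C : List (Entry n m)} {i l c j X} → j ℕ.≤ l →
                 Empty (N C j X) → Empty (N (C ++ entry i l c ∷ []) j X)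
  N-take-Empty {C = C} j≤l N-empty (e , e∈N) with N-take⁻ {C} e∈N
  ... | inj₁ e∈N′     = N-empty (e , e∈N′)
  ... | inj₂ (_ , l<j) = ℕ.<⇒≱ l<j j≤l

  N∪E : List (Entry n m) → ℕ → Subset n → Subset n → Subset n
  N∪E C j X E = N C j X ∪ (X ∩ E)

  N∪E-take-⊆ : ∀ {C : List (Entry n m)} {i l c j X E} → c ⊆ E →
               N∪E (C ++ entry i l c ∷ []) j X (E ─ c) ⊆ N∪E C j X E
  N∪E-take-⊆ {C} {c = c} {j} {X} {E} c⊆E e∈ with x∈p∪q⁻ (N (C ++ _) j X) _ e∈
  ... | inj₂ e∈X∩E─c = x∈p∪q⁺ (inj₂ (∩-monoʳ-⊆ X (p─q⊆p E c) e∈X∩E─c))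
  ... | inj₁ e∈N with N-take⁻ {C} e∈N
  ...   | inj₁ e∈N′      = x∈p∪q⁺ (inj₁ e∈N′)
  ...   | inj₂ (e∈X∩c , _) = x∈p∪q⁺ (inj₂ (∩-monoʳ-⊆ X c⊆E e∈X∩c))

  N∪E-⊆-∩ : ∀ {C : List (Entry n m)} {j X E} → Empty (N C j X) → N∪E C j X E ⊆ X ∩ E
  N∪E-⊆-∩ {C} {j} {X} N-empty e∈ with x∈p∪q⁻ (N C j X) _ e∈
  ... | inj₁ e∈N   = ⊥-elim (N-empty (_ , e∈N))
  ... | inj₂ e∈X∩E = e∈X∩E

Steps-preserves : ∀ {n m β} {F : Fin m → Subset n} (P : State n m → Set) →
                  (∀ {σ τ} → Step β F σ τ → P σ → P τ) →
                  ∀ {σ τ} → Steps β F σ τ → P σ → P τ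
Steps-preserves P step-preserves ε          = λ Pσ → Pσ
Steps-preserves P step-preserves (st ◅ sts) = Steps-preserves P step-preserves sts ∘ step-preserves st

module Buckets {n m : ℕ} {β : ℚ} (1<β : 1ℚ < β) (F : Fin m → Subset n) where

  Placed : ℕ → Subset n → Fin m → Maybe ℕ → Set
  Placed l E i nothing   = ∣ F i ∩ E ∣ ≡ 0
  Placed l E i (just l′) = l′ ℕ.≤ l × toℚ ∣ F i ∩ E ∣ < β ^ℚ suc l′

  Buckets : ℕ → Subset n → (Fin m → Maybe ℕ) → Set
  Buckets l E b = ∀ i → Placed l E i (b i)

  Placed-⊆ : ∀ {l E E′ i} → E′ ⊆ E → ∀ u → Placed l E i u → Placed l E′ i u
  Placed-⊆ {i = i} E′⊆E nothing ∣F∩E∣≡0 =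
    ℕ.n≤0⇒n≡0 (subst (∣ F i ∩ _ ∣ ℕ.≤_) ∣F∩E∣≡0 (p⊆q⇒∣p∣≤∣q∣ (∩-monoʳ-⊆ (F i) E′⊆E)))
  Placed-⊆ {i = i} E′⊆E (just l′) (l′≤l , bound) =
    l′≤l , ℚ.≤-<-trans (toℚ-mono-≤ (p⊆q⇒∣p∣≤∣q∣ (∩-monoʳ-⊆ (F i) E′⊆E))) bound

  Placed-down : ∀ {l E i} u → u ≢ just (suc l) → Placed (suc l) E i u → Placed l E i u
  Placed-down nothing   _    ∣F∩E∣≡0          = ∣F∩E∣≡0
  Placed-down (just l′) u≢l (l′≤1+l , bound) =
    ℕ.≤-pred (ℕ.≤∧≢⇒< l′≤1+l (u≢l ∘ cong just)) , bound

  Placed⇒bound : ∀ {l E i} u → Placed l E i u → toℚ ∣ F i ∩ E ∣ < β ^ℚ suc l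
  Placed⇒bound {l} nothing ∣F∩E∣≡0 =
    subst (λ a → toℚ a < β ^ℚ suc l) (sym ∣F∩E∣≡0) (^ℚ-pos 1<β (suc l))
  Placed⇒bound (just l′) (l′≤l , bound) = ℚ.<-≤-trans bound (^ℚ-monoʳ-≤ 1<β (s≤s l′≤l))

  Buckets⇒bound : ∀ {l E b} → Buckets l E b → ∀ i → toℚ ∣ F i ∩ E ∣ < β ^ℚ suc l
  Buckets⇒bound {b = b} buckets i = Placed⇒bound (b i) (buckets i)

  Buckets-initial : ∀ {L b} → CeilLog β n L →
    (∀ i → (∣ F i ∩ ⊤ ∣ ≡ 0 × b i ≡ nothing)
         ⊎ (∃ λ l → ∣ F i ∩ ⊤ ∣ ≢ 0 × FloorLog β ∣ F i ∩ ⊤ ∣ l × b i ≡ just l)) →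
    Buckets L ⊤ b
  Buckets-initial {L} {b} (n≤βᴸ , _) placement i with placement i
  ... | inj₁ (∣F∩⊤∣≡0 , bi≡nothing) = subst (Placed L ⊤ i) (sym bi≡nothing) ∣F∩⊤∣≡0
  ... | inj₂ (l , _ , (βˡ≤∣F∩⊤∣ , ∣F∩⊤∣<βˡ⁺¹) , bi≡l) =
    subst (Placed L ⊤ i) (sym bi≡l) (l≤L , ∣F∩⊤∣<βˡ⁺¹)
    where
    l≤L : l ℕ.≤ L
    l≤L = ^ℚ-cancelʳ-≤ 1<β
            (ℚ.≤-trans βˡ≤∣F∩⊤∣ (ℚ.≤-trans (toℚ-mono-≤ (∣p∣≤n (F i ∩ ⊤))) n≤βᴸ))

  Buckets-take : ∀ {l E b} i → Buckets l E b → Buckets l (E ─ (F i ∩ E)) (update b i nothing)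
  Buckets-take {l} {E} {b} i buckets =
    update⁺ (Placed l (E ─ (F i ∩ E))) (∣Empty∣≡0 (Empty[p∩[q─p∩q]] (F i) E))
            (λ i′ → Placed-⊆ (p─q⊆p E (F i ∩ E)) (b i′) (buckets i′))

  Buckets-demote : ∀ {l l′ E b} i → Buckets l E b → toℚ ∣ F i ∩ E ∣ < β ^ℚ l →
                   FloorLog β ∣ F i ∩ E ∣ l′ → Buckets l E (update b i (just l′))
  Buckets-demote {l} {E = E} i buckets ∣F∩E∣<βˡ (βˡ′≤∣F∩E∣ , ∣F∩E∣<βˡ′⁺¹) =
    update⁺ (Placed l E) (l′≤l , ∣F∩E∣<βˡ′⁺¹) buckets
    where
    l′≤l : _ ℕ.≤ l
    l′≤l = ℕ.<⇒≤ (^ℚ-cancelʳ-< 1<β (ℚ.≤-<-trans βˡ′≤∣F∩E∣ ∣F∩E∣<βˡ))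

  Buckets-discard : ∀ {l E b} i → Buckets l E b → ∣ F i ∩ E ∣ ≡ 0 →
                    Buckets l E (update b i nothing)
  Buckets-discard {l} {E} i buckets ∣F∩E∣≡0 = update⁺ (Placed l E) ∣F∩E∣≡0 buckets

  Buckets-down : ∀ {l E b} → Buckets (suc l) E b → (∀ i → b i ≢ just (suc l)) → Buckets l E b
  Buckets-down {b = b} buckets level-empty i = Placed-down (b i) (level-empty i) (buckets i)

module Invariant {n m : ℕ} {β : ℚ} (1<β : 1ℚ < β) (F : Fin m → Subset n) (s : Fin m) (j : ℕ) where
  open Buckets 1<β F

  record InvAt (l : ℕ) (E : Subset n) (b : Fin m → Maybe ℕ) (C : List (Entry n m)) : Set where
    field
      buckets : Buckets l E b
      early   : j ℕ.≤ l → Empty (N C j (F s))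
      late    : l ℕ.< j → toℚ ∣ N∪E C j (F s) E ∣ < β ^ℚ j

  Inv : State n m → Set
  Inv (state (at l) E b C) = InvAt l E b C
  Inv (state done _ _ C)   = toℚ ∣ N C j (F s) ∣ < β ^ℚ j

  N∪E-bound : ∀ {l E b} {C : List (Entry n m)} → Buckets l E b → Empty (N C j (F s)) →
              l ℕ.< j → toℚ ∣ N∪E C j (F s) E ∣ < β ^ℚ j
  N∪E-bound {b = b} {C} buckets N-empty l<j =
    ℚ.≤-<-trans (toℚ-mono-≤ (p⊆q⇒∣p∣≤∣q∣ (N∪E-⊆-∩ {C = C} N-empty)))
      (ℚ.<-≤-trans (Buckets⇒bound {b = b} buckets s) (^ℚ-monoʳ-≤ 1<β l<j))

  InvAt⇒N-bound : ∀ {l E b C} → InvAt l E b C → toℚ ∣ N C j (F s) ∣ < β ^ℚ j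
  InvAt⇒N-bound {l} {E} {C = C} inv with j ℕ.≤? l
  ... | yes j≤l =
    subst (λ a → toℚ a < β ^ℚ j) (sym (∣Empty∣≡0 (early j≤l))) (^ℚ-pos 1<β j)
    where open InvAt inv
  ... | no  j≰l =
    ℚ.≤-<-trans (toℚ-mono-≤ (p⊆q⇒∣p∣≤∣q∣ (p⊆p∪q {p = N C j (F s)} (F s ∩ E)))) (late (ℕ.≰⇒> j≰l))
    where open InvAt inv

  InvAt-rebucket : ∀ {l E b b′ C} → Buckets l E b′ → InvAt l E b C → InvAt l E b′ C
  InvAt-rebucket buckets′ inv = record { buckets = buckets′ ; early = early ; late = late }
    where open InvAt inv

  Inv-initial : ∀ {σ} → Initial β F σ → Inv σ
  Inv-initial {state _ _ b _} (L , ceil , refl , refl , refl , placement) = record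
    { buckets = buckets
    ; early   = λ _ → N-[]-Empty {m = m} {j = j}
    ; late    = N∪E-bound {b = b} {C = []} buckets (N-[]-Empty {m = m} {j = j})
    }
    where
    buckets : Buckets L ⊤ b
    buckets = Buckets-initial ceil placement

  Inv-step : ∀ {σ τ} → Step β F σ τ → Inv σ → Inv τ
  Inv-step (take {l} {E} {C = C} i _ _) inv = record
    { buckets = Buckets-take i buckets
    ; early   = λ j≤l → N-take-Empty {C = C} j≤l (early j≤l)
    ; late    = λ l<j → ℚ.≤-<-trans (toℚ-mono-≤ (p⊆q⇒∣p∣≤∣q∣ N∪E-shrinks)) (late l<j)
    }
    where
    open InvAt inv
    N∪E-shrinks : N∪E (C ++ entry i l (F i ∩ E) ∷ []) j (F s) (E ─ (F i ∩ E)) ⊆ N∪E C j (F s) E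
    N∪E-shrinks = N∪E-take-⊆ {C = C} (p∩q⊆q (F i) E)
  Inv-step (demote i _ ∣F∩E∣<βˡ _ floor) inv =
    InvAt-rebucket (Buckets-demote i (InvAt.buckets inv) ∣F∩E∣<βˡ floor) inv
  Inv-step (discard i _ ∣F∩E∣≡0) inv =
    InvAt-rebucket (Buckets-discard i (InvAt.buckets inv) ∣F∩E∣≡0) inv
  Inv-step (down {l} {E} {b} {C} level-empty) inv = record
    { buckets = buckets′
    ; early   = early ∘ ℕ.m≤n⇒m≤1+n
    ; late    = late′
    }
    where
    open InvAt inv
    buckets′ : Buckets l E b
    buckets′ = Buckets-down buckets level-empty
    late′ : l ℕ.< j → toℚ ∣ N∪E C j (F s) E ∣ < β ^ℚ j
    late′ l<j with suc l ℕ.<? j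
    ... | yes 1+l<j = late 1+l<j
    ... | no  1+l≮j = N∪E-bound {b = b} {C = C} buckets′ (early (ℕ.≮⇒≥ 1+l≮j)) l<j
  Inv-step (finish _) inv = InvAt⇒N-bound inv

mainTheorem2 : ∀ (n m : ℕ) (F : Fin m → Subset (suc n)) →
    (∀ e → ∃ λ i → e ∈ F i) →
    ∀ (β : ℚ) → 1ℚ < β →
    ∀ (C : List (Entry (suc n) m)) → Run β F C →
    ∀ (s : Fin m) (j : ℕ) → β ^ℚ j ≤ toℚ (suc n) →
    toℚ ∣ N C j (F s) ∣ < β ^ℚ j
mainTheorem2 n m F _ β 1<β C (_ , _ , _ , initial , run) s j _ =
  Steps-preserves Inv Inv-step run (Inv-initial initial)
  where open Invariant 1<β F s j
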